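{- Let $k\geq 1$ and $n_1,\dots,n_k$ be positive integers. The complete $k$-partite graph $K_{n_1,n_2,\ldots,n_k}$ satisfies the neighbour sum property if and only if it is $K_{1,1}\cong K_2$.
   Context: The complete $k$-partite graph $K_{n_1,\dots,n_k}$ has vertex set partitioned into parts of sizes $n_1,\dots,n_k$, with two vertices adjacent if and only if they lie in different parts. A graph $\mathcal G=(\mathcal V,\mathcal E)$ satisfies the neighbour sum property if there exists $f:\mathcal V\to\mathbb R$ with $f\not\equiv 0$ such that $f(x)=\sum_{y:\{x,y\}\in\mathcal E} f(y)$ for every $x\in\mathcal V$.
   Formalization: The functions f in the neighbour sum property take values in ℚ rather than ℝ. -}

module Defs where

open import Data.Nat using (ℕ; zero; suc)
open import Data.Fin using (Fin; zero; suc; _≟_)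
open import Data.Product using (Σ; _×_; _,_; proj₁)
open import Data.Rational using (ℚ; 0ℚ; _+_)
open import Relation.Nullary using (¬_; yes; no)
open import Relation.Binary.PropositionalEquality using (_≡_)

sumFin : (m : ℕ) → (Fin m → ℚ) → ℚ
sumFin zero    g = 0ℚ
sumFin (suc m) g = g zero + sumFin m (λ i → g (suc i))

Vertex : (k : ℕ) → (Fin k → ℕ) → Set
Vertex k n = Σ (Fin k) (λ i → Fin (n i))

-- Sum of f over the neighbours of x in K_{n_1,...,n_k}:
-- y is adjacent to x iff y lies in a different part from x.
neighbourSum : (k : ℕ) (n : Fin k → ℕ) → (Vertex k n → ℚ) → Vertex k n → ℚ
neighbourSum k n f x =
  sumFin k (λ i → sumFin (n i) (λ j → contrib i j))
  where
    contrib : (i : Fin k) → Fin (n i) → ℚ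
    contrib i j with i ≟ proj₁ x
    ... | yes _ = 0ℚ
    ... | no  _ = f (i , j)

NeighbourSumProperty : (k : ℕ) → (Fin k → ℕ) → Set
NeighbourSumProperty k n =
  Σ (Vertex k n → ℚ) λ f →
    (¬ (∀ v → f v ≡ 0ℚ)) × (∀ x → f x ≡ neighbourSum k n f x)

{-# OPTIONS --safe #-}
-- If f has the neighbour sum property, then f(x) = T - S_i, where T is the sum of f over
-- all vertices and S_i its sum over the part i containing x.  So f is constant, c_i say,
-- on part i, and (1 + n_i) c_i = T.  As f ≢ 0 we get T ≠ 0, and dividing by T gives
-- Σ_i n_i / (1 + n_i) = 1.  Every summand lies in [½, 1), and equals ½ only for n_i = 1,
-- which forces k = 2 and n_1 = n_2 = 1.  Conversely, on K_{1,1} the constant 1 works.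
module Submission where

open import Defs
open import Algebra.Bundles using (CommutativeRing)
open import Data.Empty using (⊥-elim)
open import Data.Fin using (Fin; zero; suc; _≟_)
open import Data.Fin.Properties using (suc-injective)
open import Data.Nat using (ℕ; zero; suc; s≤s; _≥_)
open import Data.Product using (_×_; Σ-syntax; _,_; proj₁)
open import Data.Rational using (ℚ; 0ℚ; 1ℚ; ½; _+_; _*_; _-_; 1/_; _≤_; _<_; NonZero; ≢-nonZero)
import Data.Rational.Properties as ℚ
open import Function.Base using (_∘_)
open import Function.Bundles using (_⇔_; mk⇔)
open import Relation.Binary.Definitions using (tri<; tri≈; tri>)
open import Relation.Binary.PropositionalEquality
  using (_≡_; _≢_; refl; sym; trans; cong; cong₂; subst; subst₂; module ≡-Reasoning)
open import Relation.Nullary using (¬_; yes; no)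

open import Algebra.Properties.Group ℚ.+-0-group
  using (//-rightDividesˡ; //-rightDividesʳ) renaming (∙-cancelʳ to +-cancelʳ)
open import Algebra.Properties.Semiring.Mult (CommutativeRing.semiring ℚ.+-*-commutativeRing)
  using (×-assoc-*) renaming (_×_ to _·_)

p+q≡r⇒p≡r-q : ∀ {p q r} → p + q ≡ r → p ≡ r - q
p+q≡r⇒p≡r-q {p} {q} p+q≡r = trans (sym (//-rightDividesʳ q p)) (cong (_- q) p+q≡r)

sumFin-cong : ∀ m {g h : Fin m → ℚ} → (∀ i → g i ≡ h i) → sumFin m g ≡ sumFin m h
sumFin-cong zero    g≗h = refl
sumFin-cong (suc m) g≗h = cong₂ _+_ (g≗h zero) (sumFin-cong m (g≗h ∘ suc))

sumFin-const : ∀ m x → sumFin m (λ _ → x) ≡ m · x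
sumFin-const zero    x = refl
sumFin-const (suc m) x = cong (x +_) (sumFin-const m x)

sumFin-*ʳ : ∀ m (g : Fin m → ℚ) r → sumFin m (λ i → g i * r) ≡ sumFin m g * r
sumFin-*ʳ zero    g r = sym (ℚ.*-zeroˡ r)
sumFin-*ʳ (suc m) g r = trans (cong (g zero * r +_) (sumFin-*ʳ m (g ∘ suc) r))
                              (sym (ℚ.*-distribʳ-+ r (g zero) (sumFin m (g ∘ suc))))

sumFin-nonNeg : ∀ m {g : Fin m → ℚ} → (∀ i → 0ℚ ≤ g i) → 0ℚ ≤ sumFin m g
sumFin-nonNeg zero    _   = ℚ.≤-refl
sumFin-nonNeg (suc m) 0≤g = ℚ.+-mono-≤ (0≤g zero) (sumFin-nonNeg m (0≤g ∘ suc))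

sumFin-omit : ∀ m (g h : Fin m → ℚ) p → h p ≡ 0ℚ → (∀ i → i ≢ p → h i ≡ g i) →
              sumFin m h + g p ≡ sumFin m g
sumFin-omit (suc m) g h zero hp≡0 h≗g = begin
  (h zero + sumFin m (h ∘ suc)) + g zero  ≡⟨ cong (λ y → (y + sumFin m (h ∘ suc)) + g zero) hp≡0 ⟩
  (0ℚ + sumFin m (h ∘ suc)) + g zero      ≡⟨ cong (_+ g zero) (ℚ.+-identityˡ (sumFin m (h ∘ suc))) ⟩
  sumFin m (h ∘ suc) + g zero             ≡⟨ ℚ.+-comm (sumFin m (h ∘ suc)) (g zero) ⟩
  g zero + sumFin m (h ∘ suc)             ≡⟨ cong (g zero +_) (sumFin-cong m (λ i → h≗g (suc i) λ ())) ⟩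
  g zero + sumFin m (g ∘ suc)             ∎
  where open ≡-Reasoning
sumFin-omit (suc m) g h (suc p) hp≡0 h≗g = begin
  (h zero + sumFin m (h ∘ suc)) + g (suc p)  ≡⟨ ℚ.+-assoc (h zero) (sumFin m (h ∘ suc)) (g (suc p)) ⟩
  h zero + (sumFin m (h ∘ suc) + g (suc p))  ≡⟨ cong₂ _+_ (h≗g zero λ ()) omit-rest ⟩
  g zero + sumFin m (g ∘ suc)                ∎
  where
  open ≡-Reasoning
  omit-rest : sumFin m (h ∘ suc) + g (suc p) ≡ sumFin m (g ∘ suc)
  omit-rest = sumFin-omit m (g ∘ suc) (h ∘ suc) p hp≡0 (λ i i≢p → h≗g (suc i) (i≢p ∘ suc-injective))

·-zeroʳ : ∀ m → m · 0ℚ ≡ 0ℚ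
·-zeroʳ zero    = refl
·-zeroʳ (suc m) = trans (ℚ.+-identityˡ (m · 0ℚ)) (·-zeroʳ m)

·-monoʳ-≤ : ∀ m {x y} → x ≤ y → m · x ≤ m · y
·-monoʳ-≤ zero    _   = ℚ.≤-refl
·-monoʳ-≤ (suc m) x≤y = ℚ.+-mono-≤ x≤y (·-monoʳ-≤ m x≤y)

suc·-monoʳ-< : ∀ m {x y} → x < y → suc m · x < suc m · y
suc·-monoʳ-< m x<y = ℚ.+-mono-<-≤ x<y (·-monoʳ-≤ m (ℚ.<⇒≤ x<y))

suc·-injective : ∀ m {x y} → suc m · x ≡ suc m · y → x ≡ y
suc·-injective m {x} {y} eq with ℚ.<-cmp x y
... | tri< x<y _ _ = ⊥-elim (ℚ.<-irrefl eq (suc·-monoʳ-< m x<y))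
... | tri≈ _ x≡y _ = x≡y
... | tri> _ _ y<x = ⊥-elim (ℚ.<-irrefl (sym eq) (suc·-monoʳ-< m y<x))

suc·-pos : ∀ m {x} → 0ℚ < x → 0ℚ < suc m · x
suc·-pos m {x} 0<x = subst (_< suc m · x) (·-zeroʳ (suc m)) (suc·-monoʳ-< m 0<x)

m·x≡x⇒m≡1 : ∀ m {x} → 0ℚ < x → m · x ≡ x → m ≡ 1
m·x≡x⇒m≡1 zero          0<x 0≡x = ⊥-elim (ℚ.<-irrefl 0≡x 0<x)
m·x≡x⇒m≡1 (suc zero)    0<x _   = refl
m·x≡x⇒m≡1 (suc (suc m)) {x} 0<x eq =
  ⊥-elim (ℚ.<-irrefl (trans (ℚ.+-identityʳ x) (sym eq)) (ℚ.+-monoʳ-< x (suc·-pos m 0<x)))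

half-of-sum≡1 : ∀ {x y} → ½ ≤ x → ½ ≤ y → x + y ≡ 1ℚ → x ≡ ½
half-of-sum≡1 ½≤x ½≤y x+y≡1 =
  ℚ.≤-antisym (ℚ.≮⇒≥ λ ½<x → ℚ.<-irrefl (sym x+y≡1) (ℚ.+-mono-<-≤ ½<x ½≤y)) ½≤x

sumFin≡1⇒two-halves : ∀ k (a : Fin k → ℚ) → (∀ i → ½ ≤ a i) → (∀ i → a i < 1ℚ) →
                      sumFin k a ≡ 1ℚ → k ≡ 2 × (∀ i → a i ≡ ½)
sumFin≡1⇒two-halves zero a _ _ ()
sumFin≡1⇒two-halves (suc zero) a _ a<1 Σa≡1 =
  ⊥-elim (ℚ.<-irrefl (trans (sym (ℚ.+-identityʳ (a zero))) Σa≡1) (a<1 zero))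
sumFin≡1⇒two-halves (suc (suc zero)) a ½≤a _ Σa≡1 = refl , λ
  { zero       → half-of-sum≡1 (½≤a zero) (½≤a (suc zero)) a₀+a₁≡1
  ; (suc zero) → half-of-sum≡1 (½≤a (suc zero)) (½≤a zero)
                                (trans (ℚ.+-comm (a (suc zero)) (a zero)) a₀+a₁≡1)
  }
  where
  a₀+a₁≡1 : a zero + a (suc zero) ≡ 1ℚ
  a₀+a₁≡1 = trans (cong (a zero +_) (sym (ℚ.+-identityʳ (a (suc zero))))) Σa≡1
sumFin≡1⇒two-halves (suc (suc (suc k))) a ½≤a _ Σa≡1 =
  ⊥-elim (ℚ.≤⇒≤ᵇ (subst (½ + (½ + (½ + 0ℚ)) ≤_) Σa≡1 three-halves≤Σa))
  where
  three-halves≤Σa : ½ + (½ + (½ + 0ℚ)) ≤ sumFin (suc (suc (suc k))) a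
  three-halves≤Σa =
    ℚ.+-mono-≤ (½≤a zero) (ℚ.+-mono-≤ (½≤a (suc zero)) (ℚ.+-mono-≤ (½≤a (suc (suc zero)))
      (sumFin-nonNeg k (λ i → ℚ.≤-trans (ℚ.<⇒≤ (ℚ.positive⁻¹ ½)) (½≤a (suc (suc (suc i))))))))

module _ (n : ℕ) {b : ℚ} (1+n·b≡1 : suc n · b ≡ 1ℚ) where

  suc·≡1⇒pos : 0ℚ < b
  suc·≡1⇒pos = ℚ.≰⇒> λ b≤0 →
    ℚ.≤⇒≤ᵇ (subst₂ _≤_ 1+n·b≡1 (·-zeroʳ (suc n)) (·-monoʳ-≤ (suc n) b≤0))

  suc·≡1⇒·<1 : n · b < 1ℚ
  suc·≡1⇒·<1 = subst₂ _<_ (ℚ.+-identityˡ (n · b)) 1+n·b≡1 (ℚ.+-monoˡ-< (n · b) suc·≡1⇒pos)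

  suc·≡1⇒½≤· : n ≥ 1 → ½ ≤ n · b
  suc·≡1⇒½≤· (s≤s {n = m} _) = ℚ.≮⇒≥ λ n·b<½ →
    ℚ.<-irrefl 1+n·b≡1 (ℚ.+-mono-< (ℚ.≤-<-trans {b} {n · b} {½} b≤n·b n·b<½) n·b<½)
    where
    b≤n·b : b ≤ n · b
    b≤n·b = subst (_≤ n · b) (ℚ.+-identityʳ b)
      (ℚ.+-monoʳ-≤ b (subst (_≤ m · b) (·-zeroʳ m) (·-monoʳ-≤ m (ℚ.<⇒≤ suc·≡1⇒pos))))

  suc·≡1⇒·≡½⇒≡1 : n · b ≡ ½ → n ≡ 1
  suc·≡1⇒·≡½⇒≡1 n·b≡½ = m·x≡x⇒m≡1 n suc·≡1⇒pos (trans n·b≡½ (sym b≡½))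
    where
    b≡½ : b ≡ ½
    b≡½ = +-cancelʳ ½ b ½ (trans (cong (b +_) (sym n·b≡½)) 1+n·b≡1)

partSum : ∀ {k n} → (Vertex k n → ℚ) → Fin k → ℚ
partSum {n = n} f i = sumFin (n i) (λ j → f (i , j))

totalSum : ∀ {k n} → (Vertex k n → ℚ) → ℚ
totalSum {k} f = sumFin k (partSum f)

-- The summand over part i in neighbourSum; it is local to that definition, so it is
-- recovered by unifying neighbourSum with its unfolding.
neighbourSummand : ∀ k n (f : Vertex k n → ℚ) (x : Vertex k n) → Fin k → ℚ
neighbourSummand k n f x = summand (neighbourSum k n f x) refl
  where
  summand : ∀ {g : Fin k → ℚ} t → t ≡ sumFin k g → Fin k → ℚ
  summand {g} _ _ = g

neighbourSummand-own : ∀ k n f x → neighbourSummand k n f x (proj₁ x) ≡ 0ℚ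
neighbourSummand-own k n f x with proj₁ x ≟ proj₁ x
... | yes _   = trans (sumFin-const (n (proj₁ x)) 0ℚ) (·-zeroʳ (n (proj₁ x)))
... | no  p≢p = ⊥-elim (p≢p refl)

neighbourSummand-other : ∀ k n f x i → i ≢ proj₁ x → neighbourSummand k n f x i ≡ partSum f i
neighbourSummand-other k n f x i i≢p with i ≟ proj₁ x
... | yes i≡p = ⊥-elim (i≢p i≡p)
... | no  _   = refl

neighbourSum+partSum : ∀ k n f x → neighbourSum k n f x + partSum f (proj₁ x) ≡ totalSum f
neighbourSum+partSum k n f x = sumFin-omit k (partSum f) (neighbourSummand k n f x) (proj₁ x)
  (neighbourSummand-own k n f x) (neighbourSummand-other k n f x)

module _ {k} {n : Fin k → ℕ} {f : Vertex k n → ℚ} (f≡Nf : ∀ x → f x ≡ neighbourSum k n f x) where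

  partValue : Fin k → ℚ
  partValue i = totalSum f - partSum f i

  f≡partValue : ∀ i j → f (i , j) ≡ partValue i
  f≡partValue i j = p+q≡r⇒p≡r-q
    (trans (cong (_+ partSum f i) (f≡Nf (i , j))) (neighbourSum+partSum k n f (i , j)))

  partSum≡n·partValue : ∀ i → partSum f i ≡ n i · partValue i
  partSum≡n·partValue i = trans (sumFin-cong (n i) (f≡partValue i)) (sumFin-const (n i) (partValue i))

  suc·partValue≡totalSum : ∀ i → suc (n i) · partValue i ≡ totalSum f
  suc·partValue≡totalSum i = trans (cong (partValue i +_) (sym (partSum≡n·partValue i)))
                                   (//-rightDividesˡ (partSum f i) (totalSum f))

  totalSum≢0 : ¬ (∀ v → f v ≡ 0ℚ) → totalSum f ≢ 0ℚ
  totalSum≢0 f≢0 T≡0 = f≢0 λ (i , j) → trans (f≡partValue i j) (suc·-injective (n i)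
    (trans (suc·partValue≡totalSum i) (trans T≡0 (sym (·-zeroʳ (suc (n i)))))))

neighbourSumProperty⇒fractions : ∀ k n → NeighbourSumProperty k n →
  Σ[ b ∈ (Fin k → ℚ) ] (∀ i → suc (n i) · b i ≡ 1ℚ) × sumFin k (λ i → n i · b i) ≡ 1ℚ
neighbourSumProperty⇒fractions k n (f , f≢0 , f≡Nf) = b , suc·b≡1 , Σn·b≡1
  where
  T : ℚ
  T = totalSum f

  instance
    T-nonZero : NonZero T
    T-nonZero = ≢-nonZero (totalSum≢0 f≡Nf f≢0)

  c : Fin k → ℚ
  c = partValue f≡Nf

  b : Fin k → ℚ
  b i = c i * 1/ T

  suc·b≡1 : ∀ i → suc (n i) · b i ≡ 1ℚ
  suc·b≡1 i = begin
    suc (n i) · (c i * 1/ T)  ≡⟨ ×-assoc-* (suc (n i)) (c i) (1/ T) ⟨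
    suc (n i) · c i * 1/ T    ≡⟨ cong (_* 1/ T) (suc·partValue≡totalSum f≡Nf i) ⟩
    T * 1/ T                  ≡⟨ ℚ.*-inverseʳ T ⟩
    1ℚ                        ∎
    where open ≡-Reasoning

  Σn·b≡1 : sumFin k (λ i → n i · b i) ≡ 1ℚ
  Σn·b≡1 = begin
    sumFin k (λ i → n i · (c i * 1/ T))  ≡⟨ sumFin-cong k (λ i → ×-assoc-* (n i) (c i) (1/ T)) ⟨
    sumFin k (λ i → n i · c i * 1/ T)    ≡⟨ sumFin-*ʳ k (λ i → n i · c i) (1/ T) ⟩
    sumFin k (λ i → n i · c i) * 1/ T    ≡⟨ cong (_* 1/ T) (sumFin-cong k (partSum≡n·partValue f≡Nf)) ⟨
    T * 1/ T                             ≡⟨ ℚ.*-inverseʳ T ⟩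
    1ℚ                                   ∎
    where open ≡-Reasoning

fractions⇒K₁,₁ : ∀ k (n : Fin k → ℕ) → (∀ i → n i ≥ 1) → (b : Fin k → ℚ) →
  (∀ i → suc (n i) · b i ≡ 1ℚ) → sumFin k (λ i → n i · b i) ≡ 1ℚ → k ≡ 2 × (∀ i → n i ≡ 1)
fractions⇒K₁,₁ k n n≥1 b suc·b≡1 Σn·b≡1
  with sumFin≡1⇒two-halves k (λ i → n i · b i) (λ i → suc·≡1⇒½≤· (n i) (suc·b≡1 i) (n≥1 i))
                              (λ i → suc·≡1⇒·<1 (n i) (suc·b≡1 i)) Σn·b≡1
... | k≡2 , n·b≡½ = k≡2 , λ i → suc·≡1⇒·≡½⇒≡1 (n i) (suc·b≡1 i) (n·b≡½ i)

K₁,₁-neighbourSumProperty : (n : Fin 2 → ℕ) → (∀ i → n i ≡ 1) → NeighbourSumProperty 2 n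
K₁,₁-neighbourSumProperty n n≡1 = one , one≢0 , one≡Nf
  where
  one : Vertex 2 n → ℚ
  one _ = 1ℚ

  one≢0 : ¬ (∀ v → one v ≡ 0ℚ)
  one≢0 one≡0 with one≡0 (zero , subst Fin (sym (n≡1 zero)) zero)
  ... | ()

  partSum≡1 : ∀ i → partSum one i ≡ 1ℚ
  partSum≡1 i = trans (sumFin-const (n i) 1ℚ) (cong (_· 1ℚ) (n≡1 i))

  one≡Nf : ∀ x → one x ≡ neighbourSum 2 n one x
  one≡Nf x = sym (begin
    neighbourSum 2 n one x                ≡⟨ p+q≡r⇒p≡r-q (neighbourSum+partSum 2 n one x) ⟩
    totalSum one - partSum one (proj₁ x)  ≡⟨ cong₂ _-_ (sumFin-cong 2 partSum≡1) (partSum≡1 (proj₁ x)) ⟩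
    sumFin 2 (λ _ → 1ℚ) - 1ℚ              ≡⟨⟩
    1ℚ                                    ∎)
    where open ≡-Reasoning

proposition6p4 : (k : ℕ) → k ≥ 1 → (n : Fin k → ℕ) → (∀ i → n i ≥ 1) →
    NeighbourSumProperty k n ⇔ (k ≡ 2 × (∀ i → n i ≡ 1))
proposition6p4 k _ n n≥1 = mk⇔ forward backward
  where
  forward : NeighbourSumProperty k n → k ≡ 2 × (∀ i → n i ≡ 1)
  forward nsp with neighbourSumProperty⇒fractions k n nsp
  ... | b , suc·b≡1 , Σn·b≡1 = fractions⇒K₁,₁ k n n≥1 b suc·b≡1 Σn·b≡1

  backward : k ≡ 2 × (∀ i → n i ≡ 1) → NeighbourSumProperty k n
  backward (refl , n≡1) = K₁,₁-neighbourSumProperty n n≡1
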